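{- Let $p$ and $q$ be prime numbers with $p>5$ and $q>5$. Then the Weierstrass equation $y^2=x^3-p^2x+q^2$ is a global minimal Weierstrass equation for the elliptic curve over $\mathbb{Q}$ it defines.
   Context: The discriminant of this equation is $\Delta=16(4p^6-27q^4)$. -}

module Defs where

open import Data.Nat using (ℕ; _≤_)
open import Data.Integer as Z using (ℤ; +_; ∣_∣)
open import Data.Rational as Q using (ℚ; _/_)
open import Data.Product using (_×_; Σ)
open import Relation.Binary.PropositionalEquality using (_≡_; _≢_)

-- An integral Weierstrass equation
--   y² + a₁xy + a₃y = x³ + a₂x² + a₄x + a₆ ,  all aᵢ ∈ ℤ.
record Weierstrass : Set where
  constructor [_,_,_,_,_]
  field
    a₁ a₂ a₃ a₄ a₆ : ℤ
open Weierstrass public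

module _ (E : Weierstrass) where
  open Z using (_+_; _*_; _-_; -_)
  b₂ b₄ b₆ b₈ : ℤ
  b₂ = a₁ E * a₁ E + + 4 * a₂ E
  b₄ = + 2 * a₄ E + a₁ E * a₃ E
  b₆ = a₃ E * a₃ E + + 4 * a₆ E
  b₈ = a₁ E * a₁ E * a₆ E + + 4 * a₂ E * a₆ E - a₁ E * a₃ E * a₄ E
       + a₂ E * a₃ E * a₃ E - a₄ E * a₄ E

  disc : ℤ
  disc = - (b₂ * b₂ * b₈) - + 8 * (b₄ * b₄ * b₄) - + 27 * (b₆ * b₆)
         + + 9 * b₂ * b₄ * b₆

ι : ℤ → ℚ
ι z = z / 1

-- E' is obtained from E by the admissible change of variables
--   x = u²x' + r ,  y = u³y' + su²x' + t   (u, r, s, t ∈ ℚ, u ≠ 0),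
-- i.e. (Silverman, Table 3.1)
--   u a₁' = a₁ + 2s
--   u² a₂' = a₂ - s a₁ + 3r - s²
--   u³ a₃' = a₃ + r a₁ + 2t
--   u⁴ a₄' = a₄ - s a₃ + 2 r a₂ - (t + r s) a₁ + 3r² - 2 s t
--   u⁶ a₆' = a₆ + r a₄ + r² a₂ + r³ - t a₃ - t² - r t a₁
ChangeOfVars : Weierstrass → Weierstrass → ℚ → ℚ → ℚ → ℚ → Set
ChangeOfVars E E' u r s t =
    (u * A₁' ≡ A₁ + ι (+ 2) * s)
  × (u * u * A₂' ≡ A₂ - s * A₁ + ι (+ 3) * r - s * s)
  × (u * u * u * A₃' ≡ A₃ + r * A₁ + ι (+ 2) * t)
  × (u * u * u * u * A₄' ≡ A₄ - s * A₃ + ι (+ 2) * r * A₂ - (t + r * s) * A₁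
                             + ι (+ 3) * r * r - ι (+ 2) * s * t)
  × (u * u * u * u * u * u * A₆' ≡ A₆ + r * A₄ + r * r * A₂ + r * r * r
                             - t * A₃ - t * t - r * t * A₁)
  where
  open Q using (_+_; _*_; _-_)
  A₁ = ι (a₁ E)
  A₂ = ι (a₂ E)
  A₃ = ι (a₃ E)
  A₄ = ι (a₄ E)
  A₆ = ι (a₆ E)
  A₁' = ι (a₁ E')
  A₂' = ι (a₂ E')
  A₃' = ι (a₃ E')
  A₄' = ι (a₄ E')
  A₆' = ι (a₆ E')

-- E is a global minimal Weierstrass equation (over ℚ): it defines an
-- elliptic curve (Δ ≠ 0), it is integral, and among all integral
-- Weierstrass equations for the same curve (i.e. related to E by an
-- admissible change of variables over ℚ), |Δ(E)| is minimal.
IsGlobalMinimal : Weierstrass → Set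
IsGlobalMinimal E =
  (disc E ≢ + 0) ×
  ((E' : Weierstrass) (u r s t : ℚ) → u ≢ Q.0ℚ → ChangeOfVars E E' u r s t →
     ∣ disc E ∣ ≤ ∣ disc E' ∣)

curvePQ : ℕ → ℕ → Weierstrass
curvePQ p q = [ + 0 , + 0 , + 0 , Z.- (+ (p Data.Nat.* p)) , + (q Data.Nat.* q) ]

-- The coefficients c₄ = b₂² − 24b₄ and c₆ = −b₂³ + 36b₂b₄ − 216b₆ are unchanged by the
-- translations (r, s, t) and get multiplied by u⁴ and u⁶ under the scaling u; together
-- with 1728Δ = c₄³ − c₆² this gives, for u = n/d in lowest terms, the integral relations
-- d⁶c₆ = n⁶c₆′ and d¹²Δ = n¹²Δ′.  For y² = x³ − p²x + q² we have c₆ = −864q², so n⁶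
-- divides 864q²; since q > 5 is prime this forces n = ±1, whence |Δ′| = d¹²|Δ| ≥ |Δ|.
-- Finally Δ = 16(4p⁶ − 27q⁴) is nonzero because 3 ∤ p.
module Submission where

open import Defs
open import Data.Nat as ℕ using (ℕ; zero; suc; _>_)
open import Data.Nat.Primality
  using (Prime; composite; euclidsLemma; prime⇒irreducible; prime?; prime⇒nonZero; ¬prime[1])

import Data.Nat.Properties as ℕP
open import Data.Nat.Divisibility
  using (_∣_; _∣?_; divides; ∣-refl; ∣-trans; *-pres-∣; ∣m⇒∣m*n; ∣⇒≤; ∣1⇒≡1; 0∣⇒≡0; *-cancelʳ-∣)
open import Data.Nat.Coprimality as Coprimality using (Coprime; coprime-divisor; 1-coprimeTo)
open import Data.Integer as Z using (ℤ; +_; +[1+_]; -[1+_]; ∣_∣)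
import Data.Integer.Properties as ZP
import Data.Integer.Solver as ℤ-Solver
open import Data.Rational as Q using (ℚ; mkℚ)
import Data.Rational.Properties as QP
open import Data.Rational.Unnormalised using (mkℚᵘ; *≡*)
open import Data.Rational.Solver using (module +-*-Solver)
open import Data.Fin using (Fin; zero; suc)
open import Data.Vec using (Vec; []; _∷_; lookup; map)
open import Data.Vec.Properties using (lookup-map)
open import Data.Product using (_,_)
open import Data.Sum using (inj₁; inj₂; [_,_]′)
open import Function using (_∘_; id)
open import Level using (0ℓ)
open import Algebra.Bundles using (CommutativeRing)
open import Algebra.Bundles.Raw using (RawRing)
open import Algebra.Properties.AbelianGroup ZP.+-0-abelianGroup using () renaming (∙-cancelʳ to +-cancelʳ)
open import Algebra.Properties.CommutativeSemigroup ZP.*-commutativeSemigroup using (x∙yz≈y∙xz)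
open import Algebra.Properties.CommutativeSemiring.Exp
  (CommutativeRing.commutativeSemiring QP.+-*-commutativeRing)
  using (^-distrib-*) renaming (_^_ to _^ℚ_)
open import Relation.Nullary using (¬_; yes; no; contradiction)
open import Relation.Nullary.Decidable using (from-yes; from-no)
open import Relation.Binary.PropositionalEquality hiding ([_])
open ≡-Reasoning

ι-mkℚ : ∀ z → ι z ≡ mkℚ z 0 (Coprimality.sym (1-coprimeTo ∣ z ∣))
ι-mkℚ (+ n)    = QP.normalize-coprime {n} {0} _
ι-mkℚ -[1+ n ] = cong Q.-_ (QP.normalize-coprime {suc n} {0} _)

ι-injective : ∀ {a b} → ι a ≡ ι b → a ≡ b
ι-injective {a} {b} eq = cong Q.↥_ (trans (sym (ι-mkℚ a)) (trans eq (ι-mkℚ b)))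

ι-+ : ∀ a b → ι (a Z.+ b) ≡ ι a Q.+ ι b
ι-+ a b = begin
  ι (a Z.+ b)                      ≡⟨ cong₂ (λ x y → (x Z.+ y) Q./ 1) (ZP.*-identityʳ a) (ZP.*-identityʳ b) ⟨
  (a Z.* + 1 Z.+ b Z.* + 1) Q./ 1  ≡⟨ cong₂ Q._+_ (ι-mkℚ a) (ι-mkℚ b) ⟨
  ι a Q.+ ι b                      ∎

ι-* : ∀ a b → ι (a Z.* b) ≡ ι a Q.* ι b
ι-* a b = sym (cong₂ Q._*_ (ι-mkℚ a) (ι-mkℚ b))

ι-neg : ∀ a → ι (Z.- a) ≡ Q.- ι a
ι-neg (+ 0)     = refl
ι-neg +[1+ n ]  = refl
ι-neg -[1+ n ]  = trans (ι-mkℚ +[1+ n ]) (cong Q.-_ (sym (ι-mkℚ -[1+ n ])))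

ι-^ : ∀ a n → ι (a Z.^ n) ≡ ι a ^ℚ n
ι-^ a zero    = refl
ι-^ a (suc n) = trans (ι-* a (a Z.^ n)) (cong (ι a Q.*_) (ι-^ a n))

u*↧u≡↥u : ∀ u → u Q.* ι (Q.↧ u) ≡ ι (Q.↥ u)
u*↧u≡↥u u@(mkℚ n d-1 _) = begin
  u Q.* ι (+ d)                             ≡⟨ cong (u Q.*_) (ι-mkℚ (+ d)) ⟩
  Q.fromℚᵘ (mkℚᵘ (n Z.* + d) (d-1 ℕ.* 1))  ≡⟨ QP.fromℚᵘ-cong {mkℚᵘ (n Z.* + d) (d-1 ℕ.* 1)} {mkℚᵘ n 0}
                                                                (*≡* n*d*1≡n*d) ⟩
  ι n                                       ∎
  where
  d = suc d-1
  n*d*1≡n*d : n Z.* + d Z.* + 1 ≡ n Z.* + suc (d-1 ℕ.* 1)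
  n*d*1≡n*d = trans (ZP.*-identityʳ _) (cong (λ k → n Z.* + suc k) (sym (ℕP.*-identityʳ d-1)))

clear-denominators : ∀ {x y} u k → ι x ≡ u ^ℚ k Q.* ι y → Q.↧ u Z.^ k Z.* x ≡ Q.↥ u Z.^ k Z.* y
clear-denominators {x} {y} u k eq = ι-injective (begin
  ι (Q.↧ u Z.^ k Z.* x)          ≡⟨ trans (ι-* (Q.↧ u Z.^ k) x) (cong (Q._* ι x) (ι-^ (Q.↧ u) k)) ⟩
  d ^ℚ k Q.* ι x                 ≡⟨ cong (d ^ℚ k Q.*_) eq ⟩
  d ^ℚ k Q.* (u ^ℚ k Q.* ι y)    ≡⟨ solve 3 (λ a b c → a :* (b :* c) := b :* a :* c) refl (d ^ℚ k) (u ^ℚ k) (ι y) ⟩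
  u ^ℚ k Q.* d ^ℚ k Q.* ι y      ≡⟨ cong (Q._* ι y) (^-distrib-* u d k) ⟨
  (u Q.* d) ^ℚ k Q.* ι y         ≡⟨ cong (λ v → v ^ℚ k Q.* ι y) (u*↧u≡↥u u) ⟩
  ι (Q.↥ u) ^ℚ k Q.* ι y         ≡⟨ trans (ι-* (Q.↥ u Z.^ k) y) (cong (Q._* ι y) (ι-^ (Q.↥ u) k)) ⟨
  ι (Q.↥ u Z.^ k Z.* y)          ∎)
  where
  open +-*-Solver
  d = ι (Q.↧ u)

-- Integer polynomials are kept as syntax so that one formula can be evaluated over ℤ,
-- over ℚ, and as a polynomial of the ring solver.
infixl 6 _⊕_ _⊖_
infixl 7 _⊗_
infix  8 ⊝_

data Expr (n : ℕ) : Set where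
  var     : Fin n → Expr n
  con     : ℤ → Expr n
  _⊕_ _⊗_ : Expr n → Expr n → Expr n
  ⊝_      : Expr n → Expr n

_⊖_ : ∀ {n} → Expr n → Expr n → Expr n
e ⊖ f = e ⊕ ⊝ f

module Evaluation (R : RawRing 0ℓ 0ℓ) (κ : ℤ → RawRing.Carrier R) where
  open RawRing R

  infixl 6 _-_
  _-_ : Carrier → Carrier → Carrier
  x - y = x + - y

  ⟦_⟧ : ∀ {n} → Expr n → Vec Carrier n → Carrier
  ⟦ var i ⟧ ρ = lookup ρ i
  ⟦ con c ⟧ ρ = κ c
  ⟦ e ⊕ f ⟧ ρ = ⟦ e ⟧ ρ + ⟦ f ⟧ ρ
  ⟦ e ⊗ f ⟧ ρ = ⟦ e ⟧ ρ * ⟦ f ⟧ ρ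
  ⟦ ⊝ e ⟧ ρ   = - ⟦ e ⟧ ρ

  scale : Carrier → Vec Carrier 5 → Vec Carrier 5
  scale u (x₁ ∷ x₂ ∷ x₃ ∷ x₄ ∷ x₆ ∷ []) =
    u * x₁ ∷ u * u * x₂ ∷ u * u * u * x₃ ∷ u * u * u * u * x₄ ∷ u * u * u * u * u * u * x₆ ∷ []

  shift : Carrier → Carrier → Carrier → Vec Carrier 5 → Vec Carrier 5
  shift r s t (x₁ ∷ x₂ ∷ x₃ ∷ x₄ ∷ x₆ ∷ []) =
      x₁ + κ (+ 2) * s
    ∷ x₂ - s * x₁ + κ (+ 3) * r - s * s
    ∷ x₃ + r * x₁ + κ (+ 2) * t
    ∷ x₄ - s * x₃ + κ (+ 2) * r * x₂ - (t + r * s) * x₁ + κ (+ 3) * r * r - κ (+ 2) * s * t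
    ∷ x₆ + r * x₄ + r * r * x₂ + r * r * r - t * x₃ - t * t - r * t * x₁
    ∷ []

-- Imported only now: inside Evaluation these names would clash with the ring operations.
open import Data.Nat using (_*_; _^_; _<_; _≤_)

open Evaluation Z.+-*-rawRing (λ c → c) using () renaming (⟦_⟧ to ⟦_⟧ℤ)
open Evaluation Q.+-*-rawRing ι using (scale; shift) renaming (⟦_⟧ to ⟦_⟧ℚ)

ℚ-polynomials : ℕ → RawRing 0ℓ 0ℓ
ℚ-polynomials n = record
  { Carrier = Polynomial n
  ; _≈_     = _≡_
  ; _+_     = _:+_
  ; _*_     = _:*_
  ; -_      = :-_
  ; 0#      = con Q.0ℚ
  ; 1#      = con Q.1ℚ
  }
  where open +-*-Solver

module ℚ-Polynomial {n : ℕ} = Evaluation (ℚ-polynomials n) (+-*-Solver.con ∘ ι)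
open ℚ-Polynomial using () renaming (⟦_⟧ to ⟦_⟧ᴾ; scale to scaleᴾ; shift to shiftᴾ)

ι-⟦⟧ : ∀ {n} (e : Expr n) ρ → ι (⟦ e ⟧ℤ ρ) ≡ ⟦ e ⟧ℚ (map ι ρ)
ι-⟦⟧ (var i) ρ = sym (lookup-map i ι ρ)
ι-⟦⟧ (con c) ρ = refl
ι-⟦⟧ (e ⊕ f) ρ = trans (ι-+ (⟦ e ⟧ℤ ρ) (⟦ f ⟧ℤ ρ)) (cong₂ Q._+_ (ι-⟦⟧ e ρ) (ι-⟦⟧ f ρ))
ι-⟦⟧ (e ⊗ f) ρ = trans (ι-* (⟦ e ⟧ℤ ρ) (⟦ f ⟧ℤ ρ)) (cong₂ Q._*_ (ι-⟦⟧ e ρ) (ι-⟦⟧ f ρ))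
ι-⟦⟧ (⊝ e) ρ   = trans (ι-neg (⟦ e ⟧ℤ ρ)) (cong Q.-_ (ι-⟦⟧ e ρ))

⟦⟧ℚ-≡⇒⟦⟧ℤ-≡ : ∀ {n} (e f : Expr n) ρ → ⟦ e ⟧ℚ (map ι ρ) ≡ ⟦ f ⟧ℚ (map ι ρ) → ⟦ e ⟧ℤ ρ ≡ ⟦ f ⟧ℤ ρ
⟦⟧ℚ-≡⇒⟦⟧ℤ-≡ e f ρ eq = ι-injective (trans (ι-⟦⟧ e ρ) (trans eq (sym (ι-⟦⟧ f ρ))))

coefficients : Weierstrass → Vec ℤ 5
coefficients E = a₁ E ∷ a₂ E ∷ a₃ E ∷ a₄ E ∷ a₆ E ∷ []

private
  α₁ α₂ α₃ α₄ α₆ β₂ β₄ β₆ β₈ : Expr 5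
  α₁ = var zero
  α₂ = var (suc zero)
  α₃ = var (suc (suc zero))
  α₄ = var (suc (suc (suc zero)))
  α₆ = var (suc (suc (suc (suc zero))))
  β₂ = α₁ ⊗ α₁ ⊕ con (+ 4) ⊗ α₂
  β₄ = con (+ 2) ⊗ α₄ ⊕ α₁ ⊗ α₃
  β₆ = α₃ ⊗ α₃ ⊕ con (+ 4) ⊗ α₆
  β₈ = α₁ ⊗ α₁ ⊗ α₆ ⊕ con (+ 4) ⊗ α₂ ⊗ α₆ ⊖ α₁ ⊗ α₃ ⊗ α₄ ⊕ α₂ ⊗ α₃ ⊗ α₃ ⊖ α₄ ⊗ α₄

c₄-expr c₆-expr : Expr 5
c₄-expr = β₂ ⊗ β₂ ⊖ con (+ 24) ⊗ β₄
c₆-expr = ⊝ (β₂ ⊗ β₂ ⊗ β₂) ⊕ con (+ 36) ⊗ β₂ ⊗ β₄ ⊖ con (+ 216) ⊗ β₆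

c₄ c₆ : Weierstrass → ℤ
c₄ E = ⟦ c₄-expr ⟧ℤ (coefficients E)
c₆ E = ⟦ c₆-expr ⟧ℤ (coefficients E)

4b₈≡b₂b₆-b₄² : ∀ E → + 4 Z.* b₈ E ≡ b₂ E Z.* b₆ E Z.- b₄ E Z.* b₄ E
4b₈≡b₂b₆-b₄² E = ⟦⟧ℚ-≡⇒⟦⟧ℤ-≡ (con (+ 4) ⊗ β₈) (β₂ ⊗ β₆ ⊖ β₄ ⊗ β₄) (coefficients E)
  (solve 5 (λ x₁ x₂ x₃ x₄ x₆ → let xs = x₁ ∷ x₂ ∷ x₃ ∷ x₄ ∷ x₆ ∷ [] in
                               ⟦ con (+ 4) ⊗ β₈ ⟧ᴾ xs := ⟦ β₂ ⊗ β₆ ⊖ β₄ ⊗ β₄ ⟧ᴾ xs)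
         refl (ι (a₁ E)) (ι (a₂ E)) (ι (a₃ E)) (ι (a₄ E)) (ι (a₆ E)))
  where open +-*-Solver

-- As polynomials in independent b's the two sides of 1728Δ = c₄³ − c₆² differ by a
-- multiple of 4b₈ − (b₂b₆ − b₄²).
1728Δ-in-b-coordinates : ∀ b₂ b₄ b₆ b₈ →
  + 1728 Z.* (Z.- (b₂ Z.* b₂ Z.* b₈) Z.- + 8 Z.* (b₄ Z.* b₄ Z.* b₄) Z.- + 27 Z.* (b₆ Z.* b₆)
              Z.+ + 9 Z.* b₂ Z.* b₄ Z.* b₆)
    Z.+ + 432 Z.* (b₂ Z.* b₂) Z.* (+ 4 Z.* b₈)
  ≡ (b₂ Z.* b₂ Z.- + 24 Z.* b₄) Z.^ 3
    Z.- (Z.- (b₂ Z.* b₂ Z.* b₂) Z.+ + 36 Z.* b₂ Z.* b₄ Z.- + 216 Z.* b₆) Z.^ 2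
    Z.+ + 432 Z.* (b₂ Z.* b₂) Z.* (b₂ Z.* b₆ Z.- b₄ Z.* b₄)
1728Δ-in-b-coordinates = solve 4 (λ b₂ b₄ b₆ b₈ →
    let c₄ = b₂ :* b₂ :- con (+ 24) :* b₄
        c₆ = :- (b₂ :* b₂ :* b₂) :+ con (+ 36) :* b₂ :* b₄ :- con (+ 216) :* b₆
        Δ  = :- (b₂ :* b₂ :* b₈) :- con (+ 8) :* (b₄ :* b₄ :* b₄) :- con (+ 27) :* (b₆ :* b₆)
             :+ con (+ 9) :* b₂ :* b₄ :* b₆
    in con (+ 1728) :* Δ :+ con (+ 432) :* (b₂ :* b₂) :* (con (+ 4) :* b₈)
       := c₄ :^ 3 :- c₆ :^ 2 :+ con (+ 432) :* (b₂ :* b₂) :* (b₂ :* b₆ :- b₄ :* b₄)) refl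
  where open ℤ-Solver.+-*-Solver

1728Δ≡c₄³-c₆² : ∀ E → + 1728 Z.* disc E ≡ c₄ E Z.^ 3 Z.- c₆ E Z.^ 2
1728Δ≡c₄³-c₆² E = +-cancelʳ (k Z.* (+ 4 Z.* b₈ E)) _ _ (begin
  + 1728 Z.* disc E Z.+ k Z.* (+ 4 Z.* b₈ E)
    ≡⟨ 1728Δ-in-b-coordinates (b₂ E) (b₄ E) (b₆ E) (b₈ E) ⟩
  c₄ E Z.^ 3 Z.- c₆ E Z.^ 2 Z.+ k Z.* (b₂ E Z.* b₆ E Z.- b₄ E Z.* b₄ E)
    ≡⟨ cong (λ w → c₄ E Z.^ 3 Z.- c₆ E Z.^ 2 Z.+ k Z.* w) (4b₈≡b₂b₆-b₄² E) ⟨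
  c₄ E Z.^ 3 Z.- c₆ E Z.^ 2 Z.+ k Z.* (+ 4 Z.* b₈ E) ∎)
  where k = + 432 Z.* (b₂ E Z.* b₂ E)

d¹²[A³-B²]≡[d⁴A]³-[d⁶B]² : ∀ A B d →
  d Z.^ 12 Z.* (A Z.^ 3 Z.- B Z.^ 2) ≡ (d Z.^ 4 Z.* A) Z.^ 3 Z.- (d Z.^ 6 Z.* B) Z.^ 2
d¹²[A³-B²]≡[d⁴A]³-[d⁶B]² =
  solve 3 (λ A B d → d :^ 12 :* (A :^ 3 :- B :^ 2) := (d :^ 4 :* A) :^ 3 :- (d :^ 6 :* B) :^ 2) refl
  where open ℤ-Solver.+-*-Solver

Isobaric : ℕ → Expr 5 → Set
Isobaric w e = ∀ u xs → ⟦ e ⟧ℚ (scale u xs) ≡ u ^ℚ w Q.* ⟦ e ⟧ℚ xs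

ShiftInvariant : Expr 5 → Set
ShiftInvariant e = ∀ r s t xs → ⟦ e ⟧ℚ (shift r s t xs) ≡ ⟦ e ⟧ℚ xs

c₄-isobaric : Isobaric 4 c₄-expr
c₄-isobaric u (x₁ ∷ x₂ ∷ x₃ ∷ x₄ ∷ x₆ ∷ []) =
  solve 6 (λ u x₁ x₂ x₃ x₄ x₆ → let xs = x₁ ∷ x₂ ∷ x₃ ∷ x₄ ∷ x₆ ∷ [] in
                                ⟦ c₄-expr ⟧ᴾ (scaleᴾ u xs) := u :^ 4 :* ⟦ c₄-expr ⟧ᴾ xs)
        refl u x₁ x₂ x₃ x₄ x₆
  where open +-*-Solver

c₆-isobaric : Isobaric 6 c₆-expr
c₆-isobaric u (x₁ ∷ x₂ ∷ x₃ ∷ x₄ ∷ x₆ ∷ []) =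
  solve 6 (λ u x₁ x₂ x₃ x₄ x₆ → let xs = x₁ ∷ x₂ ∷ x₃ ∷ x₄ ∷ x₆ ∷ [] in
                                ⟦ c₆-expr ⟧ᴾ (scaleᴾ u xs) := u :^ 6 :* ⟦ c₆-expr ⟧ᴾ xs)
        refl u x₁ x₂ x₃ x₄ x₆
  where open +-*-Solver

c₄-shift-invariant : ShiftInvariant c₄-expr
c₄-shift-invariant r s t (x₁ ∷ x₂ ∷ x₃ ∷ x₄ ∷ x₆ ∷ []) =
  solve 8 (λ r s t x₁ x₂ x₃ x₄ x₆ → let xs = x₁ ∷ x₂ ∷ x₃ ∷ x₄ ∷ x₆ ∷ [] in
                                    ⟦ c₄-expr ⟧ᴾ (shiftᴾ r s t xs) := ⟦ c₄-expr ⟧ᴾ xs)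
        refl r s t x₁ x₂ x₃ x₄ x₆
  where open +-*-Solver

c₆-shift-invariant : ShiftInvariant c₆-expr
c₆-shift-invariant r s t (x₁ ∷ x₂ ∷ x₃ ∷ x₄ ∷ x₆ ∷ []) =
  solve 8 (λ r s t x₁ x₂ x₃ x₄ x₆ → let xs = x₁ ∷ x₂ ∷ x₃ ∷ x₄ ∷ x₆ ∷ [] in
                                    ⟦ c₆-expr ⟧ᴾ (shiftᴾ r s t xs) := ⟦ c₆-expr ⟧ᴾ xs)
        refl r s t x₁ x₂ x₃ x₄ x₆
  where open +-*-Solver

∣i^n∣≡∣i∣^n : ∀ i n → ∣ i Z.^ n ∣ ≡ ∣ i ∣ ^ n
∣i^n∣≡∣i∣^n i zero    = refl
∣i^n∣≡∣i∣^n i (suc n) = trans (ZP.abs-* i (i Z.^ n)) (cong (∣ i ∣ *_) (∣i^n∣≡∣i∣^n i n))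

∣i^n*j∣≡∣i∣^n*∣j∣ : ∀ i n j → ∣ i Z.^ n Z.* j ∣ ≡ ∣ i ∣ ^ n * ∣ j ∣
∣i^n*j∣≡∣i∣^n*∣j∣ i n j = trans (ZP.abs-* (i Z.^ n) j) (cong (_* ∣ j ∣) (∣i^n∣≡∣i∣^n i n))

∣m*i^n∣≡m*∣i∣^n : ∀ m i n → ∣ + m Z.* i Z.^ n ∣ ≡ m * ∣ i ∣ ^ n
∣m*i^n∣≡m*∣i∣^n m i n = trans (ZP.abs-* (+ m) (i Z.^ n)) (cong (m *_) (∣i^n∣≡∣i∣^n i n))

module ChangeOfVariables (E E' : Weierstrass) (u r s t : ℚ) (φ : ChangeOfVars E E' u r s t) where

  scale≡shift : scale u (map ι (coefficients E')) ≡ shift r s t (map ι (coefficients E))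
  scale≡shift = let (h₁ , h₂ , h₃ , h₄ , h₆) = φ in
    cong₂ _∷_ h₁ (cong₂ _∷_ h₂ (cong₂ _∷_ h₃ (cong₂ _∷_ h₄ (cong₂ _∷_ h₆ refl))))

  invariant-scaling : ∀ w e → Isobaric w e → ShiftInvariant e →
    Q.↧ u Z.^ w Z.* ⟦ e ⟧ℤ (coefficients E) ≡ Q.↥ u Z.^ w Z.* ⟦ e ⟧ℤ (coefficients E')
  invariant-scaling w e isobaric invariant = clear-denominators u w (begin
    ι (⟦ e ⟧ℤ (coefficients E))                    ≡⟨ ι-⟦⟧ e (coefficients E) ⟩
    ⟦ e ⟧ℚ (map ι (coefficients E))                ≡⟨ invariant r s t _ ⟨
    ⟦ e ⟧ℚ (shift r s t (map ι (coefficients E)))  ≡⟨ cong ⟦ e ⟧ℚ scale≡shift ⟨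
    ⟦ e ⟧ℚ (scale u (map ι (coefficients E')))     ≡⟨ isobaric u _ ⟩
    u ^ℚ w Q.* ⟦ e ⟧ℚ (map ι (coefficients E'))    ≡⟨ cong (u ^ℚ w Q.*_) (ι-⟦⟧ e (coefficients E')) ⟨
    u ^ℚ w Q.* ι (⟦ e ⟧ℤ (coefficients E'))        ∎)

  c₄-scaling : Q.↧ u Z.^ 4 Z.* c₄ E ≡ Q.↥ u Z.^ 4 Z.* c₄ E'
  c₄-scaling = invariant-scaling 4 c₄-expr c₄-isobaric c₄-shift-invariant

  c₆-scaling : Q.↧ u Z.^ 6 Z.* c₆ E ≡ Q.↥ u Z.^ 6 Z.* c₆ E'
  c₆-scaling = invariant-scaling 6 c₆-expr c₆-isobaric c₆-shift-invariant

  disc-scaling : Q.↧ u Z.^ 12 Z.* disc E ≡ Q.↥ u Z.^ 12 Z.* disc E'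
  disc-scaling = ZP.*-cancelˡ-≡ (+ 1728) _ _ (begin
    + 1728 Z.* (d Z.^ 12 Z.* disc E)              ≡⟨ x∙yz≈y∙xz (+ 1728) (d Z.^ 12) (disc E) ⟩
    d Z.^ 12 Z.* (+ 1728 Z.* disc E)              ≡⟨ cong (d Z.^ 12 Z.*_) (1728Δ≡c₄³-c₆² E) ⟩
    d Z.^ 12 Z.* (c₄ E Z.^ 3 Z.- c₆ E Z.^ 2)      ≡⟨ d¹²[A³-B²]≡[d⁴A]³-[d⁶B]² (c₄ E) (c₆ E) d ⟩
    (d Z.^ 4 Z.* c₄ E) Z.^ 3 Z.- (d Z.^ 6 Z.* c₆ E) Z.^ 2
      ≡⟨ cong₂ (λ x y → x Z.^ 3 Z.- y Z.^ 2) c₄-scaling c₆-scaling ⟩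
    (n Z.^ 4 Z.* c₄ E') Z.^ 3 Z.- (n Z.^ 6 Z.* c₆ E') Z.^ 2
      ≡⟨ d¹²[A³-B²]≡[d⁴A]³-[d⁶B]² (c₄ E') (c₆ E') n ⟨
    n Z.^ 12 Z.* (c₄ E' Z.^ 3 Z.- c₆ E' Z.^ 2)    ≡⟨ cong (n Z.^ 12 Z.*_) (1728Δ≡c₄³-c₆² E') ⟨
    n Z.^ 12 Z.* (+ 1728 Z.* disc E')             ≡⟨ x∙yz≈y∙xz (n Z.^ 12) (+ 1728) (disc E') ⟩
    + 1728 Z.* (n Z.^ 12 Z.* disc E')             ∎)
    where
    n = Q.↥ u
    d = Q.↧ u

  ∣↥u∣≡1⇒∣Δ∣≤∣Δ′∣ : ∣ Q.↥ u ∣ ≡ 1 → ∣ disc E ∣ ≤ ∣ disc E' ∣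
  ∣↥u∣≡1⇒∣Δ∣≤∣Δ′∣ ∣↥u∣≡1 =
    subst (∣ disc E ∣ ≤_) d¹²∣Δ∣≡∣Δ′∣ (ℕP.m≤n*m ∣ disc E ∣ (Q.↧ₙ u ^ 12) {{ℕP.m^n≢0 (Q.↧ₙ u) 12}})
    where
    d¹²∣Δ∣≡∣Δ′∣ : Q.↧ₙ u ^ 12 * ∣ disc E ∣ ≡ ∣ disc E' ∣
    d¹²∣Δ∣≡∣Δ′∣ = begin
      Q.↧ₙ u ^ 12 * ∣ disc E ∣         ≡⟨ ∣i^n*j∣≡∣i∣^n*∣j∣ (Q.↧ u) 12 (disc E) ⟨
      ∣ Q.↧ u Z.^ 12 Z.* disc E ∣      ≡⟨ cong ∣_∣ disc-scaling ⟩
      ∣ Q.↥ u Z.^ 12 Z.* disc E' ∣     ≡⟨ ∣i^n*j∣≡∣i∣^n*∣j∣ (Q.↥ u) 12 (disc E') ⟩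
      ∣ Q.↥ u ∣ ^ 12 * ∣ disc E' ∣      ≡⟨ cong (λ m → m ^ 12 * ∣ disc E' ∣) ∣↥u∣≡1 ⟩
      1 ^ 12 * ∣ disc E' ∣              ≡⟨ ℕP.*-identityˡ ∣ disc E' ∣ ⟩
      ∣ disc E' ∣                       ∎

coprime-* : ∀ {m n o} → Coprime m n → Coprime m o → Coprime m (n * o)
coprime-* m⊥n m⊥o (i∣m , i∣n*o) =
  m⊥o (i∣m , coprime-divisor (λ (j∣i , j∣n) → m⊥n (∣-trans j∣i i∣m , j∣n)) i∣n*o)

coprime-^ʳ : ∀ {m n} k → Coprime m n → Coprime m (n ^ k)
coprime-^ʳ {m} zero    _   = Coprimality.sym (1-coprimeTo m)
coprime-^ʳ     (suc k) m⊥n = coprime-* m⊥n (coprime-^ʳ k m⊥n)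

coprime-^ : ∀ {m n} j k → Coprime m n → Coprime (m ^ j) (n ^ k)
coprime-^ j k m⊥n = Coprimality.sym (coprime-^ʳ j (Coprimality.sym (coprime-^ʳ k m⊥n)))

^-pres-∣ : ∀ {m n} k → m ∣ n → m ^ k ∣ n ^ k
^-pres-∣ zero    _   = ∣-refl
^-pres-∣ (suc k) m∣n = *-pres-∣ m∣n (^-pres-∣ k m∣n)

prime∣^⇒∣ : ∀ {p m} k → Prime p → p ∣ m ^ k → p ∣ m
prime∣^⇒∣ zero    p-prime p∣1 = contradiction (subst Prime (∣1⇒≡1 p∣1) p-prime) ¬prime[1]
prime∣^⇒∣ (suc k) p-prime p∣m^[1+k] with euclidsLemma _ _ p-prime p∣m^[1+k]
... | inj₁ p∣m   = p∣m
... | inj₂ p∣m^k = prime∣^⇒∣ k p-prime p∣m^k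

prime∤⇒coprime : ∀ {p n} → Prime p → ¬ p ∣ n → Coprime p n
prime∤⇒coprime p-prime p∤n (i∣p , i∣n) with prime⇒irreducible p-prime i∣p
... | inj₁ i≡1  = i≡1
... | inj₂ refl = contradiction i∣n p∤n

prime[3] : Prime 3
prime[3] = from-yes (prime? 3)

n^6∣864⇒n≡1 : ∀ n → n ^ 6 ∣ 864 → n ≡ 1
n^6∣864⇒n≡1 0 0∣864   = contradiction (0∣⇒≡0 0∣864) λ ()
n^6∣864⇒n≡1 1 _       = refl
n^6∣864⇒n≡1 2 64∣864  = contradiction 64∣864 (from-no (64 ∣? 864))
n^6∣864⇒n≡1 3 729∣864 = contradiction 729∣864 (from-no (729 ∣? 864))
n^6∣864⇒n≡1 (suc (suc (suc (suc k)))) n^6∣864 =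
  contradiction (ℕP.≤-trans (ℕP.^-monoˡ-≤ 6 (ℕP.m≤m+n 4 k)) (∣⇒≤ n^6∣864)) (from-no (4096 ℕP.≤? 864))

n^6∣864q²⇒n≡1 : ∀ {q} n → Prime q → 5 < q → n ^ 6 ∣ 864 * q ^ 2 → n ≡ 1
n^6∣864q²⇒n≡1 {q} n q-prime 5<q n^6∣864q² with q ∣? n
... | no q∤n = n^6∣864⇒n≡1 n (coprime-divisor n^6⊥q² (subst (n ^ 6 ∣_) (ℕP.*-comm 864 (q ^ 2)) n^6∣864q²))
  where n^6⊥q² = coprime-^ 6 2 (Coprimality.sym (prime∤⇒coprime q-prime q∤n))
... | yes q∣n = contradiction (∣⇒≤ q^4∣864) (ℕP.<⇒≱ 864<q^4)
  where
  instance q^2≢0 = ℕP.m^n≢0 q 2 {{prime⇒nonZero q-prime}}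
  q^4∣864 : q ^ 4 ∣ 864
  q^4∣864 = *-cancelʳ-∣ (q ^ 2)
    (subst (_∣ 864 * q ^ 2) (ℕP.^-distribˡ-+-* q 4 2) (∣-trans (^-pres-∣ 6 q∣n) n^6∣864q²))
  864<q^4 : 864 < q ^ 4
  864<q^4 = ℕP.<-≤-trans (from-yes (864 ℕP.<? 1296)) (ℕP.^-monoˡ-≤ 4 5<q)

4m³≢27n : ∀ {m} n → ¬ 3 ∣ m → 4 * m ^ 3 ≢ 27 * n
4m³≢27n {m} n 3∤m eq =
  [ from-no (3 ∣? 4) , 3∤m ∘ prime∣^⇒∣ 3 prime[3] ]′ (euclidsLemma 4 (m ^ 3) prime[3] 3∣4m³)
  where
  3∣4m³ : 3 ∣ 4 * m ^ 3
  3∣4m³ = subst (3 ∣_) (sym eq) (∣m⇒∣m*n n (from-yes (3 ∣? 27)))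

c₆-short : ∀ a b → c₆ [ + 0 , + 0 , + 0 , a , b ] ≡ Z.- (+ 864 Z.* b)
c₆-short a b = ⟦⟧ℚ-≡⇒⟦⟧ℤ-≡ c₆-expr (⊝ (con (+ 864) ⊗ α₆)) (coefficients [ + 0 , + 0 , + 0 , a , b ])
  (solve 2 (λ a b → let xs = con (ι (+ 0)) ∷ con (ι (+ 0)) ∷ con (ι (+ 0)) ∷ a ∷ b ∷ [] in
                    ⟦ c₆-expr ⟧ᴾ xs := ⟦ ⊝ (con (+ 864) ⊗ α₆) ⟧ᴾ xs) refl (ι a) (ι b))
  where open +-*-Solver

disc-short : ∀ a b → disc [ + 0 , + 0 , + 0 , a , b ] ≡ + 16 Z.* (+ 4 Z.* (Z.- a) Z.^ 3 Z.- + 27 Z.* b Z.^ 2)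
disc-short = solve 2 (λ a b →
  let b₂ = con (+ 0) :* con (+ 0) :+ con (+ 4) :* con (+ 0)
      b₄ = con (+ 2) :* a :+ con (+ 0) :* con (+ 0)
      b₆ = con (+ 0) :* con (+ 0) :+ con (+ 4) :* b
      b₈ = con (+ 0) :* con (+ 0) :* b :+ con (+ 4) :* con (+ 0) :* b :- con (+ 0) :* con (+ 0) :* a
           :+ con (+ 0) :* con (+ 0) :* con (+ 0) :- a :* a
  in :- (b₂ :* b₂ :* b₈) :- con (+ 8) :* (b₄ :* b₄ :* b₄) :- con (+ 27) :* (b₆ :* b₆) :+ con (+ 9) :* b₂ :* b₄ :* b₆
     := con (+ 16) :* (con (+ 4) :* (:- a) :^ 3 :- con (+ 27) :* b :^ 2)) refl
  where open ℤ-Solver.+-*-Solver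

curvePQ-nonsingular : ∀ {p} q → ¬ 3 ∣ p → disc (curvePQ p q) ≢ + 0
curvePQ-nonsingular {p} q 3∤p Δ≡0 = 4m³≢27n ((q * q) ^ 2) 3∤p*p (begin
  4 * (p * p) ^ 3                  ≡⟨ cong (λ i → 4 * ∣ i ∣ ^ 3) (ZP.neg-involutive (+ (p * p))) ⟨
  4 * ∣ Z.- a ∣ ^ 3                 ≡⟨ ∣m*i^n∣≡m*∣i∣^n 4 (Z.- a) 3 ⟨
  ∣ + 4 Z.* (Z.- a) Z.^ 3 ∣         ≡⟨ cong ∣_∣ 4[-a]³≡27b² ⟩
  ∣ + 27 Z.* (+ (q * q)) Z.^ 2 ∣    ≡⟨ ∣m*i^n∣≡m*∣i∣^n 27 (+ (q * q)) 2 ⟩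
  27 * (q * q) ^ 2                 ∎)
  where
  a = Z.- + (p * p)
  4[-a]³≡27b² : + 4 Z.* (Z.- a) Z.^ 3 ≡ + 27 Z.* (+ (q * q)) Z.^ 2
  4[-a]³≡27b² = ZP.i-j≡0⇒i≡j _ _
    ([ (λ ()) , id ]′ (ZP.i*j≡0⇒i≡0∨j≡0 (+ 16) (trans (sym (disc-short a (+ (q * q)))) Δ≡0)))
  3∤p*p : ¬ 3 ∣ p * p
  3∤p*p 3∣p*p = [ 3∤p , 3∤p ]′ (euclidsLemma p p prime[3] 3∣p*p)

∣c₆[curvePQ]∣≡864q² : ∀ p q → ∣ c₆ (curvePQ p q) ∣ ≡ 864 * q ^ 2
∣c₆[curvePQ]∣≡864q² p q = begin
  ∣ c₆ (curvePQ p q) ∣           ≡⟨ cong ∣_∣ (c₆-short (Z.- + (p * p)) (+ (q * q))) ⟩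
  ∣ Z.- (+ 864 Z.* + (q * q)) ∣  ≡⟨ ZP.∣-i∣≡∣i∣ (+ 864 Z.* + (q * q)) ⟩
  ∣ + 864 Z.* + (q * q) ∣        ≡⟨ ZP.abs-* (+ 864) (+ (q * q)) ⟩
  864 * (q * q)                  ≡⟨ cong (λ x → 864 * (q * x)) (ℕP.*-identityʳ q) ⟨
  864 * q ^ 2                    ∎

curvePQ-∣↥u∣≡1 : ∀ p q E' u r s t → ChangeOfVars (curvePQ p q) E' u r s t →
                 Prime q → 5 < q → ∣ Q.↥ u ∣ ≡ 1
curvePQ-∣↥u∣≡1 p q E' u@(mkℚ _ _ ↥u⊥↧u) r s t φ q-prime 5<q = n^6∣864q²⇒n≡1 ∣ Q.↥ u ∣ q-prime 5<q
  (coprime-divisor (coprime-^ 6 6 (Coprimality.recompute ↥u⊥↧u)) (divides ∣ c₆ E' ∣ (begin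
    Q.↧ₙ u ^ 6 * (864 * q ^ 2)             ≡⟨ cong (Q.↧ₙ u ^ 6 *_) (∣c₆[curvePQ]∣≡864q² p q) ⟨
    Q.↧ₙ u ^ 6 * ∣ c₆ (curvePQ p q) ∣      ≡⟨ ∣i^n*j∣≡∣i∣^n*∣j∣ (Q.↧ u) 6 (c₆ (curvePQ p q)) ⟨
    ∣ Q.↧ u Z.^ 6 Z.* c₆ (curvePQ p q) ∣   ≡⟨ cong ∣_∣ c₆-scaling ⟩
    ∣ Q.↥ u Z.^ 6 Z.* c₆ E' ∣              ≡⟨ ∣i^n*j∣≡∣i∣^n*∣j∣ (Q.↥ u) 6 (c₆ E') ⟩
    ∣ Q.↥ u ∣ ^ 6 * ∣ c₆ E' ∣               ≡⟨ ℕP.*-comm (∣ Q.↥ u ∣ ^ 6) ∣ c₆ E' ∣ ⟩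
    ∣ c₆ E' ∣ * ∣ Q.↥ u ∣ ^ 6               ∎)))
  where open ChangeOfVariables (curvePQ p q) E' u r s t φ using (c₆-scaling)

proposition2p1 : (p q : ℕ) → Prime p → Prime q → p > 5 → q > 5 →
    IsGlobalMinimal (curvePQ p q)
proposition2p1 p q p-prime q-prime p>5 q>5 = curvePQ-nonsingular q 3∤p , minimal
  where
  3∤p : ¬ 3 ∣ p
  3∤p 3∣p = Prime.notComposite p-prime (composite (ℕP.<-trans (from-yes (3 ℕP.<? 5)) p>5) 3∣p)

  minimal : ∀ E' u r s t → u ≢ Q.0ℚ → ChangeOfVars (curvePQ p q) E' u r s t →
            ∣ disc (curvePQ p q) ∣ ≤ ∣ disc E' ∣
  minimal E' u r s t _ φ = ∣↥u∣≡1⇒∣Δ∣≤∣Δ′∣ (curvePQ-∣↥u∣≡1 p q E' u r s t φ q-prime q>5)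
    where open ChangeOfVariables (curvePQ p q) E' u r s t φ using (∣↥u∣≡1⇒∣Δ∣≤∣Δ′∣)
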